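{- Let $G$ be a $K_2$-hamiltonian graph and let $(W,X)$ be a non-trivial partition of $V(G)$. If $G[X]$ contains two adjacent vertices and $|X|\geq 3$, then $p(G[W]) < |X|-1$ and $k(G[W]) < |X|-1$.
   Context: All graphs are finite and simple; the graph $G$ is connected, while induced subgraphs may be disconnected. A graph is hamiltonian if it has a cycle through all its vertices; $G$ is $K_2$-hamiltonian if $G-u-v$ is hamiltonian for every pair of adjacent vertices $u,v$. A non-trivial partition $(W,X)$ of $V$ is a pair of disjoint non-empty sets with union $V$. For a (possibly disconnected) graph $H$: $p(H)$ is the minimum number of pairwise vertex-disjoint paths (a single vertex counts as a path) covering all vertices of $H$; $V_1(H)$ is the set of vertices of degree $1$ in $H$; $I(H)$ is the set of components of $H$ that are isolated vertices or isolated edges (copies of $K_1$ or $K_2$), and $|I(H)|$ is their number, $H-I(H)$ denoting $H$ with these components removed. Define recursively $k(H)=0$ if $H$ has no vertices; $k(H)=\max\{1,\lceil |V_1(H)|/2\rceil\}$ if $I(H)=\emptyset$ and $H$ is non-empty; and $k(H)=|I(H)|+k(H-I(H))$ otherwise. -}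

module Defs where

open import Data.Bool using (Bool; true; false; _∧_; _∨_; not; if_then_else_)
open import Data.Nat using (ℕ; zero; suc; _+_; _≤_; _<_; _∸_; _⊔_; ⌈_/2⌉; ⌊_/2⌋; _≡ᵇ_)
open import Data.Fin using (Fin)
open import Data.Fin.Subset using (Subset; ∣_∣; _─_; ⁅_⁆; _∪_; _∩_; ∁; ⊥; ⊤; Nonempty)
  renaming (_∈_ to _∈ₛ_)
open import Data.Vec using (tabulate; lookup)
open import Data.List using (List; []; _∷_; _∷ʳ_; concat; length)
open import Data.List.Membership.Propositional using () renaming (_∈_ to _∈ₗ_)
open import Data.List.Relation.Unary.Linked using (Linked)
open import Data.List.Relation.Unary.All using (All)
open import Data.List.Relation.Unary.Unique.Propositional using (Unique)
open import Data.Product using (Σ; _×_; ∃)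
open import Function.Bundles using (_⇔_)
open import Relation.Binary.PropositionalEquality using (_≡_)

record Graph : Set where
  field
    n      : ℕ
    E      : Fin n → Fin n → Bool
    E-sym  : ∀ u v → E u v ≡ E v u
    E-irr  : ∀ v → E v v ≡ false
open Graph public

module _ (G : Graph) where

  V : Set
  V = Fin (n G)

  Adj : V → V → Set
  Adj u v = E G u v ≡ true

  data Walk : V → V → Set where
    here : ∀ {v} → Walk v v
    step : ∀ {u w v} → Adj u w → Walk w v → Walk u v

  Connected : Set
  Connected = ∀ u v → Walk u v

  Spans : Subset (n G) → List V → Set
  Spans S xs = ∀ v → (v ∈ₛ S) ⇔ (v ∈ₗ xs)

  close : List V → List V
  close []       = []
  close (x ∷ xs) = (x ∷ xs) ∷ʳ x

  -- Hamiltonian cycle of the induced subgraph G[S]: a sequence of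
  -- ≥ 3 distinct vertices, exactly S, cyclically consecutive ones adjacent.
  HamCycle : Subset (n G) → List V → Set
  HamCycle S cs = Unique cs × (3 ≤ length cs) × Linked Adj (close cs) × Spans S cs

  Hamiltonian : Subset (n G) → Set
  Hamiltonian S = ∃ λ cs → HamCycle S cs

  K2Hamiltonian : Set
  K2Hamiltonian = ∀ u v → Adj u v → Hamiltonian (∁ (⁅ u ⁆ ∪ ⁅ v ⁆))

  data NonEmptyList : List V → Set where
    ne : ∀ {x xs} → NonEmptyList (x ∷ xs)

  IsPath : List V → Set
  IsPath p = NonEmptyList p × Linked Adj p

  PathCover : Subset (n G) → List (List V) → Set
  PathCover S ps = All IsPath ps × Unique (concat ps) × Spans S (concat ps)

  IsPathCoverNumber : Subset (n G) → ℕ → Set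
  IsPathCoverNumber S m =
    (∃ λ ps → PathCover S ps × length ps ≡ m) ×
    (∀ ps → PathCover S ps → m ≤ length ps)

  nbrs : Subset (n G) → V → Subset (n G)
  nbrs S v = tabulate (λ w → lookup S w ∧ E G v w)

  deg : Subset (n G) → V → ℕ
  deg S v = ∣ nbrs S v ∣

  anyFin : ∀ {m} → (Fin m → Bool) → Bool
  anyFin {m} f = not (∣ tabulate f ∣ ≡ᵇ 0)

  isoV : Subset (n G) → V → Bool
  isoV S v = lookup S v ∧ (deg S v ≡ᵇ 0)

  -- v lies in a component of G[S] that is an isolated edge (K2):
  -- v has degree 1 and its neighbour has degree 1
  k2V : Subset (n G) → V → Bool
  k2V S v = lookup S v ∧ (deg S v ≡ᵇ 1) ∧
            anyFin (λ w → lookup S w ∧ E G v w ∧ (deg S w ≡ᵇ 1))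

  IVerts : Subset (n G) → Subset (n G)
  IVerts S = tabulate (λ v → isoV S v ∨ k2V S v)

  -- |I(G[S])| = #K1-components + #K2-components
  numI : Subset (n G) → ℕ
  numI S = ∣ tabulate (isoV S) ∣ + ⌊ ∣ tabulate (k2V S) ∣ /2⌋

  V1 : Subset (n G) → Subset (n G)
  V1 S = tabulate (λ v → lookup S v ∧ (deg S v ≡ᵇ 1))

  -- the recursive definition of k, with fuel (each recursive call removes
  -- at least one vertex, so fuel n+1 suffices)
  kF : ℕ → Subset (n G) → ℕ
  kF zero    S = 0
  kF (suc f) S =
    if ∣ S ∣ ≡ᵇ 0 then 0
    else (if numI S ≡ᵇ 0 then (1 ⊔ ⌈ ∣ V1 S ∣ /2⌉)
          else numI S + kF f (S ─ IVerts S))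

  k : Subset (n G) → ℕ
  k S = kF (suc (n G)) S

  NonTrivialPartition : Subset (n G) → Subset (n G) → Set
  NonTrivialPartition W X = (W ∩ X ≡ ⊥) × (W ∪ X ≡ ⊤) × Nonempty W × Nonempty X

-- Let uv be an edge of G[X]. Since |X| ≥ 3 there is a third vertex x ∈ X; it lies on a
-- hamiltonian cycle of G − u − v, and deleting x from that cycle leaves a hamiltonian path
-- of G − u − v − x. Cutting this path at its vertices outside W leaves a cover of G[W] by at
-- most 1 + (|X| − 3) paths, so p(G[W]) ≤ |X| − 2.
--
-- For k it suffices that k(H) never exceeds the size of a path cover of H. In a cover, a
-- vertex of degree 0 in H is both end vertices of its path and a vertex of degree 1 is an
-- end vertex of its path; counting end vertices bounds ⌈|V₁(H)|/2⌉ and, for the paths inside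
-- the components in I(H) (a path never leaves its component), also |I(H)|. The remaining
-- paths cover H − I(H), which gives the recursive case.

module Submission where

open import Defs

open import Data.Bool using (Bool; true; false; T; not; _∧_)
open import Data.Bool.Properties using (T-≡; T-∧; T-∨)
open import Data.Empty using (⊥-elim)
open import Data.Fin using (Fin; zero; suc)
open import Data.Fin.Properties using (_≟_; any?)
open import Data.Fin.Subset
  using (Subset; ∣_∣; _─_; _-_; _∩_; _∪_; ∁; ⁅_⁆; ⊥; ⊤; Empty; inside; outside)
  renaming (_∈_ to _∈ₛ_; _∉_ to _∉ₛ_; _⊆_ to _⊆ₛ_)
open import Data.Fin.Subset.Properties
  using ( nonempty?; Empty-unique; ∣⊥∣≡0; p─⊥≡p; p─q⊆p; p⊆q⇒∣p∣≤∣q∣; x∈p⇒∣p-x∣<∣p∣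
        ; x∈p∧x≢y⇒x∈p-y; x∈p∧x∉q⇒x∈p─q; x∈⁅x⁆; x∈⁅y⁆⇒x≡y; x∉p⇒x∈∁p; x∈∁p⇒x∉p; ∉⊥; ∈⊤
        ; x∈p∩q⁺; x∈p∩q⁻; x∈p∪q⁺; x∈p∪q⁻)
  renaming (_∈?_ to _∈ₛ?_)
open import Data.List using (List; []; _∷_; _++_; [_]; concat; filter; length; head; last; mapMaybe)
open import Data.List.Properties using (length-++; length-mapMaybe; ++-identityʳ; ++-assoc)
open import Data.List.Membership.Propositional using (_∈_; _∉_)
open import Data.List.Membership.Propositional.Properties
  using (∈-++⁺ˡ; ∈-++⁺ʳ; ∈-∃++; ∈-concat⁺′; ∈-concat⁻′; ∈-filter⁺; ∈-filter⁻)
open import Data.List.Relation.Binary.Permutation.Propositional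
  using (_↭_; ↭-trans; ↭-sym; prep; ↭⇒↭ₛ)
open import Data.List.Relation.Binary.Permutation.Propositional.Properties
  using (shift; ++-comm; ∈-resp-↭)
import Data.List.Relation.Binary.Permutation.Setoid.Properties as PermutationSetoid
open import Data.List.Relation.Binary.Sublist.Propositional using (_⊆_; []; _∷_; _∷ʳ_; ⊆-refl)
open import Data.List.Relation.Binary.Sublist.Propositional.Properties
  using (All-resp-⊆; Any-resp-⊆; ++⁺; ++⁺ˡ; ++⁺ʳ; filter-⊆)
open import Data.List.Relation.Unary.All as All using (All; []; _∷_; all?)
import Data.List.Relation.Unary.All.Properties as AllP
open import Data.List.Relation.Unary.AllPairs as AllPairs using ([]; _∷_)
open import Data.List.Relation.Unary.Any using (here; there)
open import Data.List.Relation.Unary.Linked as Linked using (Linked; []; [-]; _∷_)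
open import Data.List.Relation.Unary.Unique.Propositional using (Unique)
import Data.List.Relation.Unary.Unique.Propositional.Properties as UniqueP
open import Data.Maybe using (Maybe; just; nothing)
open import Data.Nat using (ℕ; zero; suc; _+_; _∸_; _≤_; _<_; z≤n; s≤s; _≡ᵇ_; ⌊_/2⌋; ⌈_/2⌉)
open import Data.Nat.Properties
  using ( module ≤-Reasoning; +-suc; +-assoc; +-mono-≤; n≤1+n; ≤-refl; ≤-reflexive; ≤-trans
        ; ≤-<-trans; <⇒≢; <⇒≱; ⊔-lub; ≡ᵇ⇒≡; ≡⇒≡ᵇ; ⌊n/2⌋-mono; ⌈n/2⌉-mono; n≡⌊n+n/2⌋; n≡⌈n+n/2⌉)
open import Data.Product using (_×_; _,_; ∃; ∃₂; proj₁; proj₂; map₁; map₂; uncurry)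
open import Data.Sum as Sum using (_⊎_; inj₁; inj₂; [_,_]′)
open import Data.Vec as Vec using (_∷_; tabulate; lookup)
open import Data.Vec.Properties using (lookup∘tabulate; []=⇒lookup; lookup⇒[]=)
open import Function using (_∘_; id; Equivalence; mk⇔)
open import Level using (Level)
open import Relation.Binary using (Rel)
open import Relation.Binary.PropositionalEquality
  using (_≡_; _≢_; refl; sym; trans; cong; subst; subst₂; setoid)
open import Relation.Nullary using (Dec; yes; no; ¬?; contradiction)
open import Relation.Nullary.Decidable
  using (isYes; fromWitness; toWitness; _×-dec_; decidable-stable)
open import Relation.Unary using (Pred; Decidable)

module _ {A : Set} where

  Unique-⊆ : {xs ys : List A} → xs ⊆ ys → Unique ys → Unique xs
  Unique-⊆ []         []       = []
  Unique-⊆ (_ ∷ʳ σ)   (_ ∷ u)  = Unique-⊆ σ u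
  Unique-⊆ (refl ∷ σ) (x∉ ∷ u) = All-resp-⊆ σ x∉ ∷ Unique-⊆ σ u

  Unique-++⇒≢ : ∀ {xs ys : List A} {x y} → Unique (xs ++ ys) → x ∈ xs → y ∈ ys → x ≢ y
  Unique-++⇒≢ {_ ∷ xs} (x∉ ∷ _) (here refl) y∈ys = All.lookup x∉ (∈-++⁺ʳ xs y∈ys)
  Unique-++⇒≢ (_ ∷ u) (there x∈xs) y∈ys = Unique-++⇒≢ u x∈xs y∈ys

  ∈⇒⊆concat : ∀ {xs : List A} {xss} → xs ∈ xss → xs ⊆ concat xss
  ∈⇒⊆concat (here refl)             = ++⁺ʳ _ ⊆-refl
  ∈⇒⊆concat {xss = ys ∷ _} (there m) = ++⁺ˡ ys (∈⇒⊆concat m)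

  concat-filter-⊆ : ∀ {p} {P : Pred (List A) p} (P? : Decidable P) xss →
    concat (filter P? xss) ⊆ concat xss
  concat-filter-⊆ P? []         = []
  concat-filter-⊆ P? (xs ∷ xss) with P? xs
  ... | yes _ = ++⁺ ⊆-refl (concat-filter-⊆ P? xss)
  ... | no  _ = ++⁺ˡ xs (concat-filter-⊆ P? xss)

  length-filter+length-filter-¬ : ∀ {p} {P : Pred A p} (P? : Decidable P) xs →
    length (filter P? xs) + length (filter (¬? ∘ P?) xs) ≡ length xs
  length-filter+length-filter-¬ P? [] = refl
  length-filter+length-filter-¬ P? (x ∷ xs) with P? x
  ... | yes _ = cong suc (length-filter+length-filter-¬ P? xs)
  ... | no  _ = trans (+-suc _ _) (cong suc (length-filter+length-filter-¬ P? xs))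

  Unique-resp-↭ : ∀ {xs ys : List A} → xs ↭ ys → Unique xs → Unique ys
  Unique-resp-↭ = PermutationSetoid.Unique-resp-↭ (setoid A) ∘ ↭⇒↭ₛ

  last-++-[_] : ∀ (xs : List A) x → last (xs ++ [ x ]) ≡ just x
  last-++-[_] []           x = refl
  last-++-[_] (_ ∷ [])     x = refl
  last-++-[_] (_ ∷ y ∷ xs) x = last-++-[_] (y ∷ xs) x

  ∈-mapMaybe⁺ : ∀ {B : Set} {f : A → Maybe B} {x y xs} →
    f x ≡ just y → x ∈ xs → y ∈ mapMaybe f xs
  ∈-mapMaybe⁺ {f = f} {x} fx≡y (here refl) with f x | fx≡y
  ... | just _ | refl = here refl
  ∈-mapMaybe⁺ {f = f} {xs = z ∷ _} fx≡y (there m) with f z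
  ... | just _  = there (∈-mapMaybe⁺ fx≡y m)
  ... | nothing = ∈-mapMaybe⁺ fx≡y m

module _ {A : Set} {ℓ : Level} {R : Rel A ℓ} where

  Linked-++⁻ˡ : ∀ xs {ys} → Linked R (xs ++ ys) → Linked R xs
  Linked-++⁻ˡ []           _       = []
  Linked-++⁻ˡ (_ ∷ [])     _       = [-]
  Linked-++⁻ˡ (_ ∷ y ∷ xs) (r ∷ l) = r ∷ Linked-++⁻ˡ (y ∷ xs) l

  Linked-++⁻ʳ : ∀ xs {ys} → Linked R (xs ++ ys) → Linked R ys
  Linked-++⁻ʳ []       l = l
  Linked-++⁻ʳ (_ ∷ xs) l = Linked-++⁻ʳ xs (Linked.tail l)

  Linked-join : ∀ xs {y ys} → Linked R (xs ++ [ y ]) → Linked R (y ∷ ys) → Linked R (xs ++ y ∷ ys)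
  Linked-join []           _       l = l
  Linked-join (_ ∷ [])     (r ∷ _) l = r ∷ l
  Linked-join (_ ∷ x ∷ xs) (r ∷ k) l = r ∷ Linked-join (x ∷ xs) k l

  Linked-predecessor : ∀ x xs {v ys} → Linked R (x ∷ xs ++ v ∷ ys) → ∃ λ u → u ∈ x ∷ xs × R u v
  Linked-predecessor x []       (r ∷ _) = x , here refl , r
  Linked-predecessor x (y ∷ xs) (_ ∷ l) with Linked-predecessor y xs l
  ... | u , u∈ , r = u , there u∈ , r

  Linked-successor : ∀ xs {v w ys} → Linked R (xs ++ v ∷ w ∷ ys) → R v w
  Linked-successor xs l = Linked.head (Linked-++⁻ʳ xs l)

module _ {A : Set} {p : Level} {P : Pred A p} (P? : Decidable P) where

  private
    addBlock : List A → List (List A) → List (List A)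
    addBlock []       bss = bss
    addBlock (x ∷ xs) bss = (x ∷ xs) ∷ bss

    -- The run of P-elements at the front of the list, and the maximal runs after it.
    blocks⁺ : List A → List A × List (List A)
    blocks⁺ []       = [] , []
    blocks⁺ (x ∷ xs) with P? x
    ... | yes _ = map₁ (x ∷_) (blocks⁺ xs)
    ... | no  _ = [] , uncurry addBlock (blocks⁺ xs)

    first-block-prefix : ∀ xs → ∃ λ rest → xs ≡ proj₁ (blocks⁺ xs) ++ rest
    first-block-prefix []       = [] , refl
    first-block-prefix (x ∷ xs) with P? x
    ... | yes _ = map₂ (cong (x ∷_)) (first-block-prefix xs)
    ... | no  _ = x ∷ xs , refl

    concat-addBlock : ∀ b bss → concat (addBlock b bss) ≡ b ++ concat bss
    concat-addBlock []      bss = refl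
    concat-addBlock (_ ∷ _) bss = refl

    length-addBlock : ∀ b bss → length (addBlock b bss) ≤ suc (length bss)
    length-addBlock []      bss = n≤1+n _
    length-addBlock (_ ∷ _) bss = ≤-refl

  blocks : List A → List (List A)
  blocks xs = uncurry addBlock (blocks⁺ xs)

  module _ {ℓ : Level} {R : Rel A ℓ} where

    private
      NonEmptyLinked : List A → Set _
      NonEmptyLinked b = b ≢ [] × Linked R b

      addBlock-All : ∀ {b bss} → Linked R b → All NonEmptyLinked bss →
        All NonEmptyLinked (addBlock b bss)
      addBlock-All {[]}    _ a = a
      addBlock-All {_ ∷ _} l a = ((λ ()) , l) ∷ a

      first-block-Linked : ∀ {xs} → Linked R xs → Linked R (proj₁ (blocks⁺ xs))
      first-block-Linked {xs} l with first-block-prefix xs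
      ... | rest , xs≡ = Linked-++⁻ˡ _ (subst (Linked R) xs≡ l)

      later-blocks-Linked : ∀ {xs} → Linked R xs → All NonEmptyLinked (proj₂ (blocks⁺ xs))
      later-blocks-Linked {[]}     _ = []
      later-blocks-Linked {x ∷ xs} l with P? x
      ... | yes _ = later-blocks-Linked (Linked.tail l)
      ... | no  _ =
        addBlock-All (first-block-Linked (Linked.tail l)) (later-blocks-Linked (Linked.tail l))

    blocks-Linked : ∀ {xs} → Linked R xs → All (λ b → b ≢ [] × Linked R b) (blocks xs)
    blocks-Linked l = addBlock-All (first-block-Linked l) (later-blocks-Linked l)

  concat-blocks : ∀ xs → concat (blocks xs) ≡ filter P? xs
  concat-blocks xs = trans (concat-addBlock (proj₁ (blocks⁺ xs)) _) (blocks⁺-filter xs)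
    where
    blocks⁺-filter : ∀ xs → proj₁ (blocks⁺ xs) ++ concat (proj₂ (blocks⁺ xs)) ≡ filter P? xs
    blocks⁺-filter []       = refl
    blocks⁺-filter (x ∷ xs) with P? x
    ... | yes _ = cong (x ∷_) (blocks⁺-filter xs)
    ... | no  _ = trans (concat-addBlock (proj₁ (blocks⁺ xs)) _) (blocks⁺-filter xs)

  length-blocks : ∀ xs → length (blocks xs) ≤ suc (length (filter (¬? ∘ P?) xs))
  length-blocks xs = ≤-trans (length-addBlock (proj₁ (blocks⁺ xs)) _) (s≤s (later-blocks xs))
    where
    later-blocks : ∀ xs → length (proj₂ (blocks⁺ xs)) ≤ length (filter (¬? ∘ P?) xs)
    later-blocks []       = z≤n
    later-blocks (x ∷ xs) with P? x
    ... | yes _ = later-blocks xs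
    ... | no  _ = ≤-trans (length-addBlock (proj₁ (blocks⁺ xs)) _) (s≤s (later-blocks xs))

m+m+n≤o+o⇒m+⌊n/2⌋≤o : ∀ {m n o} → m + m + n ≤ o + o → m + ⌊ n /2⌋ ≤ o
m+m+n≤o+o⇒m+⌊n/2⌋≤o {m} {n} {o} le =
  subst₂ _≤_ (⌊m+m+n/2⌋≡m+⌊n/2⌋ m) (sym (n≡⌊n+n/2⌋ o)) (⌊n/2⌋-mono le)
  where
  ⌊m+m+n/2⌋≡m+⌊n/2⌋ : ∀ m → ⌊ m + m + n /2⌋ ≡ m + ⌊ n /2⌋
  ⌊m+m+n/2⌋≡m+⌊n/2⌋ zero    = refl
  ⌊m+m+n/2⌋≡m+⌊n/2⌋ (suc m) rewrite +-suc m m = cong suc (⌊m+m+n/2⌋≡m+⌊n/2⌋ m)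

m≤n+n⇒⌈m/2⌉≤n : ∀ {m n} → m ≤ n + n → ⌈ m /2⌉ ≤ n
m≤n+n⇒⌈m/2⌉≤n {n = n} le = subst (_ ≤_) (sym (n≡⌈n+n/2⌉ n)) (⌈n/2⌉-mono le)

2+m≤n⇒m<n∸1 : ∀ {m n} → 2 + m ≤ n → m < n ∸ 1
2+m≤n⇒m<n∸1 (s≤s 1+m≤n∸1) = 1+m≤n∸1

private variable m : ℕ

x∈p─q⇒x∉q : ∀ (p q : Subset m) {x} → x ∈ₛ p ─ q → x ∉ₛ q
x∈p─q⇒x∉q (_ ∷ _) (outside ∷ _) Vec.here       ()
x∈p─q⇒x∉q (_ ∷ p) (_ ∷ q)       (Vec.there x∈) (Vec.there x∈q) = x∈p─q⇒x∉q p q x∈ x∈q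

∣p∣≤1+∣p-x∣ : ∀ (p : Subset m) x → ∣ p ∣ ≤ suc ∣ p - x ∣
∣p∣≤1+∣p-x∣ (inside  ∷ p) zero    = ≤-reflexive (cong (suc ∘ ∣_∣) (sym (p─⊥≡p p)))
∣p∣≤1+∣p-x∣ (outside ∷ p) zero    = ≤-trans (≤-reflexive (cong ∣_∣ (sym (p─⊥≡p p)))) (n≤1+n _)
∣p∣≤1+∣p-x∣ (inside  ∷ p) (suc x) = s≤s (∣p∣≤1+∣p-x∣ p x)
∣p∣≤1+∣p-x∣ (outside ∷ p) (suc x) = ∣p∣≤1+∣p-x∣ p x

Empty⇒∣p∣≡0 : {p : Subset m} → Empty p → ∣ p ∣ ≡ 0
Empty⇒∣p∣≡0 {m} empty = trans (cong ∣_∣ (Empty-unique empty)) (∣⊥∣≡0 m)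

∣p∣≤length : ∀ (p : Subset m) xs → (∀ {x} → x ∈ₛ p → x ∈ xs) → ∣ p ∣ ≤ length xs
∣p∣≤length p [] p⊆[] = ≤-reflexive (Empty⇒∣p∣≡0 p-empty)
  where
  p-empty : Empty p
  p-empty (_ , x∈p) with p⊆[] x∈p
  ... | ()
∣p∣≤length p (y ∷ xs) p⊆y∷xs = ≤-trans (∣p∣≤1+∣p-x∣ p y) (s≤s (∣p∣≤length (p - y) xs p-y⊆xs))
  where
  p-y⊆xs : ∀ {x} → x ∈ₛ p - y → x ∈ xs
  p-y⊆xs {x} x∈p-y with p⊆y∷xs (p─q⊆p p ⁅ y ⁆ x∈p-y)
  ... | here refl = ⊥-elim (x∈p─q⇒x∉q p ⁅ y ⁆ x∈p-y (x∈⁅x⁆ y))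
  ... | there x∈xs = x∈xs

length≤∣p∣ : ∀ (p : Subset m) {xs} → Unique xs → All (_∈ₛ p) xs → length xs ≤ ∣ p ∣
length≤∣p∣ p []          []           = z≤n
length≤∣p∣ p (x∉ ∷ uniq) (x∈p ∷ xs⊆p) =
  ≤-trans (s≤s (length≤∣p∣ (p - _) uniq (All.zipWith in-p-x (xs⊆p , x∉)))) (x∈p⇒∣p-x∣<∣p∣ x∈p)
  where
  in-p-x : ∀ {y} → y ∈ₛ p × _ ≢ y → y ∈ₛ p - _
  in-p-x (y∈p , x≢y) = x∈p∧x≢y⇒x∈p-y y∈p (x≢y ∘ sym)

∣p∩q∣+∣p∪q∣≡∣p∣+∣q∣ : ∀ (p q : Subset m) → ∣ p ∩ q ∣ + ∣ p ∪ q ∣ ≡ ∣ p ∣ + ∣ q ∣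
∣p∩q∣+∣p∪q∣≡∣p∣+∣q∣ Vec.[]        Vec.[]        = refl
∣p∩q∣+∣p∪q∣≡∣p∣+∣q∣ (inside  ∷ p) (inside  ∷ q) =
  cong suc (trans (+-suc _ _) (trans (cong suc (∣p∩q∣+∣p∪q∣≡∣p∣+∣q∣ p q)) (sym (+-suc _ _))))
∣p∩q∣+∣p∪q∣≡∣p∣+∣q∣ (inside  ∷ p) (outside ∷ q) =
  trans (+-suc _ _) (cong suc (∣p∩q∣+∣p∪q∣≡∣p∣+∣q∣ p q))
∣p∩q∣+∣p∪q∣≡∣p∣+∣q∣ (outside ∷ p) (inside  ∷ q) =
  trans (+-suc _ _) (trans (cong suc (∣p∩q∣+∣p∪q∣≡∣p∣+∣q∣ p q)) (sym (+-suc _ _)))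
∣p∩q∣+∣p∪q∣≡∣p∣+∣q∣ (outside ∷ p) (outside ∷ q) = ∣p∩q∣+∣p∪q∣≡∣p∣+∣q∣ p q

∈-tabulate⁺ : ∀ (f : Fin m → Bool) {x} → T (f x) → x ∈ₛ tabulate f
∈-tabulate⁺ f {x} t = lookup⇒[]= x _ (trans (lookup∘tabulate f x) (Equivalence.to T-≡ t))

∈-tabulate⁻ : ∀ (f : Fin m → Bool) {x} → x ∈ₛ tabulate f → T (f x)
∈-tabulate⁻ f {x} x∈ = Equivalence.from T-≡ (trans (sym (lookup∘tabulate f x)) ([]=⇒lookup x∈))

∈⇒T-lookup : ∀ {p : Subset m} {x} → x ∈ₛ p → T (lookup p x)
∈⇒T-lookup x∈p = Equivalence.from T-≡ ([]=⇒lookup x∈p)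

T-lookup⇒∈ : ∀ {p : Subset m} {x} → T (lookup p x) → x ∈ₛ p
T-lookup⇒∈ {p = p} {x} t = lookup⇒[]= x p (Equivalence.to T-≡ t)

∈-∁-pair⁺ : ∀ {u v x : Fin m} → x ≢ u → x ≢ v → x ∈ₛ ∁ (⁅ u ⁆ ∪ ⁅ v ⁆)
∈-∁-pair⁺ {u = u} {v} x≢u x≢v =
  x∉p⇒x∈∁p λ x∈ → [ x≢u ∘ x∈⁅y⁆⇒x≡y u , x≢v ∘ x∈⁅y⁆⇒x≡y v ]′ (x∈p∪q⁻ ⁅ u ⁆ ⁅ v ⁆ x∈)

∈-∁-pair⁻ : ∀ {u v x : Fin m} → x ∈ₛ ∁ (⁅ u ⁆ ∪ ⁅ v ⁆) → x ≢ u × x ≢ v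
∈-∁-pair⁻ {u = u} {v} x∈ =
  (λ { refl → x∈∁p⇒x∉p x∈ (x∈p∪q⁺ (inj₁ (x∈⁅x⁆ u))) }) ,
  (λ { refl → x∈∁p⇒x∉p x∈ (x∈p∪q⁺ {p = ⁅ u ⁆} (inj₂ (x∈⁅x⁆ v))) })

∈q⇒∉p : ∀ {p q : Subset m} {x} → p ∩ q ≡ ⊥ → x ∈ₛ q → x ∉ₛ p
∈q⇒∉p p∩q≡⊥ x∈q x∈p = ∉⊥ (subst (_ ∈ₛ_) p∩q≡⊥ (x∈p∩q⁺ (x∈p , x∈q)))

∉p⇒∈q : ∀ {p q : Subset m} {x} → p ∪ q ≡ ⊤ → x ∉ₛ p → x ∈ₛ q
∉p⇒∈q {p = p} {q} {x} p∪q≡⊤ x∉p =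
  [ (λ x∈p → contradiction x∈p x∉p) , id ]′ (x∈p∪q⁻ p q (subst (x ∈ₛ_) (sym p∪q≡⊤) ∈⊤))

module _ {m : ℕ} where
  open import Data.List.Membership.DecPropositional (_≟_ {m}) using (_∈?_)

  support : List (Fin m) → Subset m
  support xs = tabulate (λ x → isYes (x ∈? xs))

  ∈-support⁺ : ∀ {x xs} → x ∈ xs → x ∈ₛ support xs
  ∈-support⁺ x∈xs = ∈-tabulate⁺ _ (fromWitness x∈xs)

  ∣support∣≤length : ∀ xs → ∣ support xs ∣ ≤ length xs
  ∣support∣≤length xs = ∣p∣≤length (support xs) xs (toWitness ∘ ∈-tabulate⁻ _)

  double-count : ∀ (Z O : Subset m) xs ys → Empty (Z ∩ O) →
    (∀ {x} → x ∈ₛ Z → x ∈ xs × x ∈ ys) → (∀ {x} → x ∈ₛ O → x ∈ xs ⊎ x ∈ ys) →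
    ∣ Z ∣ + ∣ Z ∣ + ∣ O ∣ ≤ length xs + length ys
  double-count Z O xs ys Z∩O-empty Z⊆xs∩ys O⊆xs∪ys = begin
    ∣ Z ∣ + ∣ Z ∣ + ∣ O ∣               ≡⟨ +-assoc ∣ Z ∣ _ _ ⟩
    ∣ Z ∣ + (∣ Z ∣ + ∣ O ∣)             ≡⟨ cong (∣ Z ∣ +_) (∣p∩q∣+∣p∪q∣≡∣p∣+∣q∣ Z O) ⟨
    ∣ Z ∣ + (∣ Z ∩ O ∣ + ∣ Z ∪ O ∣)     ≡⟨ cong (λ k → ∣ Z ∣ + (k + ∣ Z ∪ O ∣)) (Empty⇒∣p∣≡0 Z∩O-empty) ⟩
    ∣ Z ∣ + ∣ Z ∪ O ∣                   ≤⟨ +-mono-≤ (p⊆q⇒∣p∣≤∣q∣ Z⊆H∩L) (p⊆q⇒∣p∣≤∣q∣ Z∪O⊆H∪L) ⟩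
    ∣ H ∩ L ∣ + ∣ H ∪ L ∣               ≡⟨ ∣p∩q∣+∣p∪q∣≡∣p∣+∣q∣ H L ⟩
    ∣ H ∣ + ∣ L ∣                       ≤⟨ +-mono-≤ (∣support∣≤length xs) (∣support∣≤length ys) ⟩
    length xs + length ys               ∎
    where
    open ≤-Reasoning
    H = support xs
    L = support ys
    Z⊆H∩L : Z ⊆ₛ H ∩ L
    Z⊆H∩L x∈Z with Z⊆xs∩ys x∈Z
    ... | x∈xs , x∈ys = x∈p∩q⁺ (∈-support⁺ x∈xs , ∈-support⁺ x∈ys)
    Z∪O⊆H∪L : Z ∪ O ⊆ₛ H ∪ L
    Z∪O⊆H∪L x∈Z∪O with x∈p∪q⁻ Z O x∈Z∪O
    ... | inj₁ x∈Z = x∈p∪q⁺ (inj₁ (∈-support⁺ (proj₁ (Z⊆xs∩ys x∈Z))))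
    ... | inj₂ x∈O = x∈p∪q⁺ (Sum.map ∈-support⁺ ∈-support⁺ (O⊆xs∪ys x∈O))

  length<∣p∣⇒∃∈p∖xs : ∀ (p : Subset m) xs → length xs < ∣ p ∣ → ∃ λ x → x ∈ₛ p × x ∉ xs
  length<∣p∣⇒∃∈p∖xs p xs len< with any? (λ x → x ∈ₛ? p ×-dec ¬? (x ∈? xs))
  ... | yes found = found
  ... | no  none  = contradiction (∣p∣≤length p xs p⊆xs) (<⇒≱ len<)
    where
    p⊆xs : ∀ {x} → x ∈ₛ p → x ∈ xs
    p⊆xs x∈p = decidable-stable (_ ∈? xs) (λ x∉xs → none (_ , x∈p , x∉xs))

-- Degrees and path covers

module _ (G : Graph) where

  private
    variable
      S : Subset (n G)
      u v w : V G

  Adj-sym : Adj G u v → Adj G v u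
  Adj-sym {u} {v} uv = trans (E-sym G v u) uv

  Adj-irrefl : Adj G u v → u ≢ v
  Adj-irrefl {u} uv refl = contradiction (trans (sym uv) (E-irr G u)) λ ()

  ∈-nbrs⁺ : w ∈ₛ S → Adj G v w → w ∈ₛ nbrs G S v
  ∈-nbrs⁺ w∈S vw = ∈-tabulate⁺ _ (Equivalence.from T-∧ (∈⇒T-lookup w∈S , Equivalence.from T-≡ vw))

  length≤deg : ∀ {ws} → Unique ws → All (λ w → w ∈ₛ S × Adj G v w) ws → length ws ≤ deg G S v
  length≤deg uniq nbrs = length≤∣p∣ _ uniq (All.map (λ (w∈S , vw) → ∈-nbrs⁺ w∈S vw) nbrs)

  nbr⇒1≤deg : w ∈ₛ S → Adj G v w → 1 ≤ deg G S v
  nbr⇒1≤deg w∈S vw = length≤deg ([] ∷ []) ((w∈S , vw) ∷ [])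

  distinct-nbrs⇒2≤deg : ∀ {w′} → w ≢ w′ → w ∈ₛ S → Adj G v w → w′ ∈ₛ S → Adj G v w′ → 2 ≤ deg G S v
  distinct-nbrs⇒2≤deg w≢w′ w∈S vw w′∈S vw′ =
    length≤deg ((w≢w′ ∷ []) ∷ [] ∷ []) ((w∈S , vw) ∷ (w′∈S , vw′) ∷ [])

  IsPathIn : Subset (n G) → List (V G) → Set
  IsPathIn S q = IsPath G q × Unique q × All (_∈ₛ S) q

  private
    predecessor⇒1≤deg : ∀ a pre {post} → Linked (Adj G) (a ∷ pre ++ v ∷ post) →
      All (_∈ₛ S) (a ∷ pre ++ v ∷ post) → 1 ≤ deg G S v
    predecessor⇒1≤deg a pre linked inS with Linked-predecessor a pre linked
    ... | b , b∈ , bv = nbr⇒1≤deg (All.lookup inS (∈-++⁺ˡ b∈)) (Adj-sym bv)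

    successor⇒1≤deg : ∀ pre {c post} → Linked (Adj G) (pre ++ v ∷ c ∷ post) →
      All (_∈ₛ S) (pre ++ v ∷ c ∷ post) → 1 ≤ deg G S v
    successor⇒1≤deg pre linked inS =
      nbr⇒1≤deg (All.lookup inS (∈-++⁺ʳ pre (there (here refl)))) (Linked-successor pre linked)

    interior⇒2≤deg : ∀ a pre {c post} → Linked (Adj G) (a ∷ pre ++ v ∷ c ∷ post) →
      Unique (a ∷ pre ++ v ∷ c ∷ post) → All (_∈ₛ S) (a ∷ pre ++ v ∷ c ∷ post) → 2 ≤ deg G S v
    interior⇒2≤deg a pre linked uniq inS with Linked-predecessor a pre linked
    ... | b , b∈ , bv =
      distinct-nbrs⇒2≤deg (Unique-++⇒≢ {xs = a ∷ pre} uniq b∈ (there (here refl)))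
        (All.lookup inS (∈-++⁺ˡ b∈)) (Adj-sym bv)
        (All.lookup inS (∈-++⁺ʳ (a ∷ pre) (there (here refl)))) (Linked-successor (a ∷ pre) linked)

  deg≡0⇒head∧last : ∀ {q} → IsPathIn S q → v ∈ q → deg G S v ≡ 0 → head q ≡ just v × last q ≡ just v
  deg≡0⇒head∧last {S} {v} ((_ , linked) , _ , inS) v∈q deg≡0 with ∈-∃++ v∈q
  ... | pre , post , refl = sides pre post linked inS
    where
    sides : ∀ pre post → Linked (Adj G) (pre ++ v ∷ post) → All (_∈ₛ S) (pre ++ v ∷ post) →
      head (pre ++ v ∷ post) ≡ just v × last (pre ++ v ∷ post) ≡ just v
    sides []        []      _      _   = refl , refl
    sides []        (_ ∷ _) linked inS =
      contradiction (sym deg≡0) (<⇒≢ (successor⇒1≤deg [] linked inS))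
    sides (a ∷ pre) _       linked inS =
      contradiction (sym deg≡0) (<⇒≢ (predecessor⇒1≤deg a pre linked inS))

  deg≡1⇒head∨last : ∀ {q} → IsPathIn S q → v ∈ q → deg G S v ≡ 1 → head q ≡ just v ⊎ last q ≡ just v
  deg≡1⇒head∨last {S} {v} ((_ , linked) , uniq , inS) v∈q deg≡1 with ∈-∃++ v∈q
  ... | pre , post , refl = sides pre post linked uniq inS
    where
    sides : ∀ pre post → Linked (Adj G) (pre ++ v ∷ post) → Unique (pre ++ v ∷ post) →
      All (_∈ₛ S) (pre ++ v ∷ post) →
      head (pre ++ v ∷ post) ≡ just v ⊎ last (pre ++ v ∷ post) ≡ just v
    sides []        _       _      _    _   = inj₁ refl
    sides (a ∷ pre) []      _      _    _   = inj₂ (last-++-[_] (a ∷ pre) v)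
    sides (a ∷ pre) (_ ∷ _) linked uniq inS =
      contradiction (sym deg≡1) (<⇒≢ (interior⇒2≤deg a pre linked uniq inS))

  PathCover⇒IsPathIn : ∀ {ps} → PathCover G S ps → All (IsPathIn S) ps
  PathCover⇒IsPathIn {ps = ps} (paths , uniq , spans) = All.tabulate path-in
    where
    path-in : ∀ {q} → q ∈ ps → IsPathIn _ q
    path-in q∈ps = All.lookup paths q∈ps , Unique-⊆ (∈⇒⊆concat q∈ps) uniq ,
                   All.tabulate (λ x∈q → Equivalence.from (spans _) (∈-concat⁺′ x∈q q∈ps))

  deg≡0⇒first∧last : ∀ {qs q} → All (IsPathIn S) qs → q ∈ qs → v ∈ q → deg G S v ≡ 0 →
    v ∈ mapMaybe head qs × v ∈ mapMaybe last qs
  deg≡0⇒first∧last paths q∈qs v∈q deg≡0 with deg≡0⇒head∧last (All.lookup paths q∈qs) v∈q deg≡0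
  ... | hd , lt = ∈-mapMaybe⁺ hd q∈qs , ∈-mapMaybe⁺ lt q∈qs

  deg≡1⇒first∨last : ∀ {qs q} → All (IsPathIn S) qs → q ∈ qs → v ∈ q → deg G S v ≡ 1 →
    v ∈ mapMaybe head qs ⊎ v ∈ mapMaybe last qs
  deg≡1⇒first∨last paths q∈qs v∈q deg≡1 =
    Sum.map (λ hd → ∈-mapMaybe⁺ hd q∈qs) (λ lt → ∈-mapMaybe⁺ lt q∈qs)
      (deg≡1⇒head∨last (All.lookup paths q∈qs) v∈q deg≡1)

  ∣V1∣≤2·length : ∀ {ps} → PathCover G S ps → ∣ V1 G S ∣ ≤ length ps + length ps
  ∣V1∣≤2·length {S} {ps} cover@(_ , _ , spans) = begin
    ∣ V1 G S ∣
      ≤⟨ ∣p∣≤length _ _ V1⊆ends ⟩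
    length (mapMaybe head ps ++ mapMaybe last ps)
      ≡⟨ length-++ (mapMaybe head ps) ⟩
    length (mapMaybe head ps) + length (mapMaybe last ps)
      ≤⟨ +-mono-≤ (length-mapMaybe head ps) (length-mapMaybe last ps) ⟩
    length ps + length ps ∎
    where
    open ≤-Reasoning
    V1⊆ends : ∀ {v} → v ∈ₛ V1 G S → v ∈ mapMaybe head ps ++ mapMaybe last ps
    V1⊆ends {v} v∈V1 with Equivalence.to T-∧ (∈-tabulate⁻ _ v∈V1)
    ... | v∈S , deg≡ᵇ1 with ∈-concat⁻′ ps (Equivalence.to (spans v) (T-lookup⇒∈ v∈S))
    ...   | q , v∈q , q∈ps =
      [ ∈-++⁺ˡ , ∈-++⁺ʳ _ ]′
        (deg≡1⇒first∨last (PathCover⇒IsPathIn cover) q∈ps v∈q (≡ᵇ⇒≡ _ 1 deg≡ᵇ1))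

  T-anyFin⁺ : ∀ (f : V G → Bool) {x} → T (f x) → T (anyFin G f)
  T-anyFin⁺ f fx with ∣ tabulate f ∣ | length≤∣p∣ (tabulate f) ([] ∷ []) (∈-tabulate⁺ f fx ∷ [])
  ... | suc _ | _ = _

  T-anyFin⁻ : ∀ (f : V G → Bool) → T (anyFin G f) → ∃ (T ∘ f)
  T-anyFin⁻ f any with nonempty? (tabulate f)
  ... | yes (x , x∈) = x , ∈-tabulate⁻ f x∈
  ... | no  empty    = contradiction (subst (λ k → T (not (k ≡ᵇ 0))) (Empty⇒∣p∣≡0 empty) any) λ ()

  isoV⁻ : ∀ {S v} → T (isoV G S v) → v ∈ₛ S × deg G S v ≡ 0
  isoV⁻ iso with Equivalence.to T-∧ iso
  ... | v∈S , deg≡ᵇ0 = T-lookup⇒∈ v∈S , ≡ᵇ⇒≡ _ 0 deg≡ᵇ0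

  k2V⁻ : ∀ {S v} → T (k2V G S v) →
    v ∈ₛ S × deg G S v ≡ 1 × ∃ λ w → w ∈ₛ S × Adj G v w × deg G S w ≡ 1
  k2V⁻ k2 with Equivalence.to T-∧ k2
  ... | v∈S , rest with Equivalence.to T-∧ rest
  ...   | deg≡ᵇ1 , any with T-anyFin⁻ _ any
  ...     | w , nbr with Equivalence.to T-∧ nbr
  ...       | w∈S , rest′ with Equivalence.to T-∧ rest′
  ...         | vw , deg-w≡ᵇ1 =
    T-lookup⇒∈ v∈S , ≡ᵇ⇒≡ _ 1 deg≡ᵇ1 ,
    w , T-lookup⇒∈ w∈S , Equivalence.to T-≡ vw , ≡ᵇ⇒≡ _ 1 deg-w≡ᵇ1

  k2V⁺ : v ∈ₛ S → deg G S v ≡ 1 → w ∈ₛ S → Adj G v w → deg G S w ≡ 1 → T (k2V G S v)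
  k2V⁺ {w = w} v∈S deg≡1 w∈S vw deg-w≡1 =
    T-∧-intro (∈⇒T-lookup v∈S)
      (T-∧-intro (≡⇒≡ᵇ _ 1 deg≡1)
        (T-anyFin⁺ _ {w} (T-∧-intro (∈⇒T-lookup w∈S)
          (T-∧-intro (Equivalence.from T-≡ vw) (≡⇒≡ᵇ _ 1 deg-w≡1)))))
    where
    T-∧-intro : ∀ {a b} → T a → T b → T (a ∧ b)
    T-∧-intro ta tb = Equivalence.from T-∧ (ta , tb)

  isoV⇒∈IVerts : ∀ {S v} → T (isoV G S v) → v ∈ₛ IVerts G S
  isoV⇒∈IVerts = ∈-tabulate⁺ _ ∘ Equivalence.from T-∨ ∘ inj₁

  k2V⇒∈IVerts : ∀ {S v} → T (k2V G S v) → v ∈ₛ IVerts G S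
  k2V⇒∈IVerts = ∈-tabulate⁺ _ ∘ Equivalence.from T-∨ ∘ inj₂

  IVerts-closed : u ∈ₛ S → w ∈ₛ S → Adj G u w → u ∈ₛ IVerts G S → w ∈ₛ IVerts G S
  IVerts-closed {S = S} u∈S w∈S uw u∈I with Equivalence.to T-∨ (∈-tabulate⁻ _ u∈I)
  ... | inj₁ iso = contradiction (sym (proj₂ (isoV⁻ {S = S} iso))) (<⇒≢ (nbr⇒1≤deg w∈S uw))
  ... | inj₂ k2 with k2V⁻ {S = S} k2
  ...   | _ , deg≡1 , w′ , w′∈S , uw′ , deg-w′≡1 with _ ≟ w′
  ...     | no w≢w′  = contradiction (sym deg≡1) (<⇒≢ (distinct-nbrs⇒2≤deg w≢w′ w∈S uw w′∈S uw′))
  ...     | yes refl = k2V⇒∈IVerts {S} (k2V⁺ w∈S deg-w′≡1 u∈S (Adj-sym uw) deg≡1)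

  path-inside∨outside-IVerts : ∀ {q} → Linked (Adj G) q → All (_∈ₛ S) q →
    All (_∈ₛ IVerts G S) q ⊎ All (_∉ₛ IVerts G S) q
  path-inside∨outside-IVerts {S} {[]}    _ _ = inj₁ []
  path-inside∨outside-IVerts {S} {x ∷ []} _ _ with x ∈ₛ? IVerts G S
  ... | yes x∈I = inj₁ (x∈I ∷ [])
  ... | no  x∉I = inj₂ (x∉I ∷ [])
  path-inside∨outside-IVerts {S} {x ∷ y ∷ _} (xy ∷ linked) (x∈S ∷ inS@(y∈S ∷ _))
    with path-inside∨outside-IVerts linked inS
  ... | inj₁ all∈@(y∈I ∷ _) = inj₁ (IVerts-closed y∈S x∈S (Adj-sym xy) y∈I ∷ all∈)
  ... | inj₂ all∉@(y∉I ∷ _) = inj₂ ((λ x∈I → y∉I (IVerts-closed x∈S y∈S xy x∈I)) ∷ all∉)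

  cover⇒1≤length : ∀ {ps} → PathCover G S ps → (∣ S ∣ ≡ᵇ 0) ≡ false → 1 ≤ length ps
  cover⇒1≤length {ps = _ ∷ _} _ _ = s≤s z≤n
  cover⇒1≤length {S} {[]} (_ , _ , spans) ∣S∣≢0 =
    contradiction (trans (cong (_≡ᵇ 0) (sym (Empty⇒∣p∣≡0 S-empty))) ∣S∣≢0) λ ()
    where
    S-empty : Empty S
    S-empty (v , v∈S) with Equivalence.to (spans v) v∈S
    ... | ()

  module _ (S : Subset (n G)) where

    private
      I = IVerts G S

      inside? : (q : List (V G)) → Dec (All (_∈ₛ I) q)
      inside? = all? (_∈ₛ? I)

    in-IVerts⇒on-inside-path : ∀ {ps v} → PathCover G S ps → v ∈ₛ S → v ∈ₛ I →
      ∃ λ q → q ∈ filter inside? ps × v ∈ q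
    in-IVerts⇒on-inside-path {ps} {v} cover@(_ , _ , spans) v∈S v∈I
      with ∈-concat⁻′ ps (Equivalence.to (spans v) v∈S)
    ... | q , v∈q , q∈ps with All.lookup (PathCover⇒IsPathIn cover) q∈ps
    ...   | (_ , linked) , _ , inS with path-inside∨outside-IVerts linked inS
    ...     | inj₁ all∈ = q , ∈-filter⁺ inside? q∈ps all∈ , v∈q
    ...     | inj₂ all∉ = contradiction v∈I (All.lookup all∉ v∈q)

    outside-cover : ∀ {ps} → PathCover G S ps → PathCover G (S ─ I) (filter (¬? ∘ inside?) ps)
    outside-cover {ps} cover@(paths , uniq , spans) =
      AllP.filter⁺ (¬? ∘ inside?) paths ,
      Unique-⊆ (concat-filter-⊆ (¬? ∘ inside?) ps) uniq ,
      λ v → mk⇔ (to v) (from v)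
      where
      to : ∀ v → v ∈ₛ S ─ I → v ∈ concat (filter (¬? ∘ inside?) ps)
      to v v∈S─I with ∈-concat⁻′ ps (Equivalence.to (spans v) (p─q⊆p S I v∈S─I))
      ... | q , v∈q , q∈ps =
        ∈-concat⁺′ v∈q
          (∈-filter⁺ (¬? ∘ inside?) q∈ps (λ all∈ → x∈p─q⇒x∉q S I v∈S─I (All.lookup all∈ v∈q)))
      from : ∀ v → v ∈ concat (filter (¬? ∘ inside?) ps) → v ∈ₛ S ─ I
      from v v∈ with ∈-concat⁻′ (filter (¬? ∘ inside?) ps) v∈
      ... | q , v∈q , q∈ with ∈-filter⁻ (¬? ∘ inside?) q∈
      ...   | q∈ps , ¬all∈ with All.lookup (PathCover⇒IsPathIn cover) q∈ps
      ...     | (_ , linked) , _ , inS with path-inside∨outside-IVerts linked inS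
      ...       | inj₁ all∈ = contradiction all∈ ¬all∈
      ...       | inj₂ all∉ = x∈p∧x∉q⇒x∈p─q (All.lookup inS v∈q) (All.lookup all∉ v∈q)

    numI≤length-inside : ∀ {ps} → PathCover G S ps → numI G S ≤ length (filter inside? ps)
    numI≤length-inside {ps} cover = m+m+n≤o+o⇒m+⌊n/2⌋≤o {∣ Z ∣} (begin
      ∣ Z ∣ + ∣ Z ∣ + ∣ O ∣
        ≤⟨ double-count Z O (mapMaybe head qs) (mapMaybe last qs)
             Z∩O-empty Z⊆firsts∩lasts O⊆firsts∪lasts ⟩
      length (mapMaybe head qs) + length (mapMaybe last qs)
        ≤⟨ +-mono-≤ (length-mapMaybe head qs) (length-mapMaybe last qs) ⟩
      length qs + length qs ∎)
      where
      open ≤-Reasoning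
      Z = tabulate (isoV G S)
      O = tabulate (k2V G S)
      qs = filter inside? ps
      paths : All (IsPathIn S) qs
      paths = AllP.filter⁺ inside? (PathCover⇒IsPathIn cover)
      Z∩O-empty : Empty (Z ∩ O)
      Z∩O-empty (v , v∈Z∩O) with x∈p∩q⁻ Z O v∈Z∩O
      ... | v∈Z , v∈O = contradiction (trans (sym (proj₂ (isoV⁻ {S} (∈-tabulate⁻ _ v∈Z))))
                                              (proj₁ (proj₂ (k2V⁻ {S} (∈-tabulate⁻ _ v∈O))))) λ ()
      Z⊆firsts∩lasts : ∀ {v} → v ∈ₛ Z → v ∈ mapMaybe head qs × v ∈ mapMaybe last qs
      Z⊆firsts∩lasts v∈Z with isoV⁻ {S} (∈-tabulate⁻ _ v∈Z)
      ... | v∈S , deg≡0 with in-IVerts⇒on-inside-path cover v∈S (isoV⇒∈IVerts {S} (∈-tabulate⁻ _ v∈Z))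
      ...   | q , q∈qs , v∈q = deg≡0⇒first∧last paths q∈qs v∈q deg≡0
      O⊆firsts∪lasts : ∀ {v} → v ∈ₛ O → v ∈ mapMaybe head qs ⊎ v ∈ mapMaybe last qs
      O⊆firsts∪lasts v∈O with k2V⁻ {S} (∈-tabulate⁻ _ v∈O)
      ... | v∈S , deg≡1 , _ with in-IVerts⇒on-inside-path cover v∈S (k2V⇒∈IVerts {S} (∈-tabulate⁻ _ v∈O))
      ...   | q , q∈qs , v∈q = deg≡1⇒first∨last paths q∈qs v∈q deg≡1

  k≤length-cover : ∀ fuel S {ps} → PathCover G S ps → kF G fuel S ≤ length ps
  k≤length-cover zero       _ _ = z≤n
  k≤length-cover (suc fuel) S {ps} cover with ∣ S ∣ ≡ᵇ 0 in ∣S∣≢0 | numI G S ≡ᵇ 0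
  ... | true  | _     = z≤n
  ... | false | true  = ⊔-lub (cover⇒1≤length cover ∣S∣≢0) (m≤n+n⇒⌈m/2⌉≤n (∣V1∣≤2·length cover))
  ... | false | false = begin
    numI G S + kF G fuel (S ─ IVerts G S)
      ≤⟨ +-mono-≤ (numI≤length-inside S cover) (k≤length-cover fuel _ (outside-cover S cover)) ⟩
    length (filter inside? ps) + length (filter (¬? ∘ inside?) ps)
      ≡⟨ length-filter+length-filter-¬ inside? ps ⟩
    length ps ∎
    where
    open ≤-Reasoning
    inside? = all? (_∈ₛ? IVerts G S)

  -- A short path cover of G[W]

  Linked-close⇒Linked-rotation : ∀ pre {x post} → Linked (Adj G) (close G (pre ++ x ∷ post)) →
    Linked (Adj G) (post ++ pre)
  Linked-close⇒Linked-rotation [] {post = post} closed =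
    subst (Linked (Adj G)) (sym (++-identityʳ post)) (Linked-++⁻ˡ post (Linked.tail closed))
  Linked-close⇒Linked-rotation (c ∷ pre) {x} {post} closed =
    Linked-join post (Linked.tail (Linked-++⁻ʳ (c ∷ pre) closed′)) (Linked-++⁻ˡ (c ∷ pre) closed′)
    where
    closed′ : Linked (Adj G) ((c ∷ pre) ++ x ∷ post ++ [ c ])
    closed′ = subst (Linked (Adj G)) (cong (c ∷_) (++-assoc pre (x ∷ post) [ c ])) closed

  HamCycle-minus-vertex : ∀ {C cs x} → HamCycle G C cs → x ∈ cs →
    ∃ λ path → Linked (Adj G) path × cs ↭ x ∷ path
  HamCycle-minus-vertex (_ , _ , closed , _) x∈cs with ∈-∃++ x∈cs
  ... | pre , post , refl =
    post ++ pre ,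
    Linked-close⇒Linked-rotation pre closed ,
    ↭-trans (shift _ pre post) (prep _ (++-comm pre post))

  ≢[]⇒NonEmptyList : ∀ {xs} → xs ≢ [] → NonEmptyList G xs
  ≢[]⇒NonEmptyList {[]}    xs≢[] = contradiction refl xs≢[]
  ≢[]⇒NonEmptyList {_ ∷ _} _     = ne

  blocks-PathCover : ∀ W {path} → Linked (Adj G) path → Unique path → (∀ {y} → y ∈ₛ W → y ∈ path) →
    PathCover G W (blocks (_∈ₛ? W) path)
  blocks-PathCover W {path} linked uniq W⊆path =
    All.map (λ (b≢[] , b-linked) → ≢[]⇒NonEmptyList b≢[] , b-linked) (blocks-Linked W? linked) ,
    subst Unique (sym (concat-blocks W? path)) (UniqueP.filter⁺ W? uniq) ,
    subst (Spans G W) (sym (concat-blocks W? path))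
      (λ y → mk⇔ (λ y∈W → ∈-filter⁺ W? (W⊆path y∈W) y∈W) (proj₂ ∘ ∈-filter⁻ W? {xs = path}))
    where
    W? = _∈ₛ? W

  K2Hamiltonian⇒short-path-cover : K2Hamiltonian G → ∀ W X → W ∩ X ≡ ⊥ → W ∪ X ≡ ⊤ →
    u ∈ₛ X → v ∈ₛ X → Adj G u v → 3 ≤ ∣ X ∣ →
    ∃ λ ps → PathCover G W ps × 2 + length ps ≤ ∣ X ∣
  K2Hamiltonian⇒short-path-cover {u} {v} k2 W X W∩X≡⊥ W∪X≡⊤ u∈X v∈X uv 3≤∣X∣
    with k2 u v uv | length<∣p∣⇒∃∈p∖xs X (u ∷ v ∷ []) 3≤∣X∣
  ... | cs , cycle@(uniq , _ , _ , spans) | x , x∈X , x∉uv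
    with HamCycle-minus-vertex cycle
           (Equivalence.to (spans x) (∈-∁-pair⁺ (x∉uv ∘ here) (x∉uv ∘ there ∘ here)))
  ... | path , linked , cs↭x∷path =
    blocks W? path , blocks-PathCover W linked (AllPairs.tail uniq′) W⊆path , bound
    where
    W? = _∈ₛ? W
    bad = filter (¬? ∘ W?) path

    uniq′ : Unique (x ∷ path)
    uniq′ = Unique-resp-↭ cs↭x∷path uniq

    avoids-uv : ∀ {y} → y ∈ x ∷ path → y ≢ u × y ≢ v
    avoids-uv y∈ = ∈-∁-pair⁻ (Equivalence.from (spans _) (∈-resp-↭ (↭-sym cs↭x∷path) y∈))

    W⊆path : ∀ {y} → y ∈ₛ W → y ∈ path
    W⊆path {y} y∈W
      with ∈-resp-↭ cs↭x∷path (Equivalence.to (spans y)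
             (∈-∁-pair⁺ (λ { refl → ∈q⇒∉p W∩X≡⊥ u∈X y∈W }) (λ { refl → ∈q⇒∉p W∩X≡⊥ v∈X y∈W })))
    ... | here refl    = contradiction y∈W (∈q⇒∉p W∩X≡⊥ x∈X)
    ... | there y∈path = y∈path

    x∷bad⊆x∷path : x ∷ bad ⊆ x ∷ path
    x∷bad⊆x∷path = refl ∷ filter-⊆ (¬? ∘ W?) path

    distinct : Unique (u ∷ v ∷ x ∷ bad)
    distinct = (Adj-irrefl uv ∷ All.tabulate (λ y∈ → proj₁ (avoids-uv′ y∈) ∘ sym)) ∷
               All.tabulate (λ y∈ → proj₂ (avoids-uv′ y∈) ∘ sym) ∷
               Unique-⊆ x∷bad⊆x∷path uniq′
      where
      avoids-uv′ : ∀ {y} → y ∈ x ∷ bad → y ≢ u × y ≢ v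
      avoids-uv′ = avoids-uv ∘ Any-resp-⊆ x∷bad⊆x∷path

    in-X : All (_∈ₛ X) (u ∷ v ∷ x ∷ bad)
    in-X = u∈X ∷ v∈X ∷ x∈X ∷
           All.tabulate (λ y∈bad → ∉p⇒∈q W∪X≡⊤ (proj₂ (∈-filter⁻ (¬? ∘ W?) {xs = path} y∈bad)))

    bound : 2 + length (blocks W? path) ≤ ∣ X ∣
    bound = ≤-trans (s≤s (s≤s (length-blocks W? path))) (length≤∣p∣ X distinct in-X)

lemma2 : (G : Graph) → Connected G → K2Hamiltonian G →
    (W X : Subset (n G)) → NonTrivialPartition G W X →
    (∃₂ λ u v → u ∈ₛ X × v ∈ₛ X × Adj G u v) → 3 ≤ ∣ X ∣ →
    (∀ m → IsPathCoverNumber G W m → m < ∣ X ∣ ∸ 1) × (k G W < ∣ X ∣ ∸ 1)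
lemma2 G _ k2 W X (W∩X≡⊥ , W∪X≡⊤ , _ , _) (u , v , u∈X , v∈X , uv) 3≤∣X∣
  with K2Hamiltonian⇒short-path-cover G k2 W X W∩X≡⊥ W∪X≡⊤ u∈X v∈X uv 3≤∣X∣
... | ps , cover , 2+∣ps∣≤∣X∣ =
  (λ m (_ , m-minimal) → ≤-<-trans (m-minimal ps cover) (2+m≤n⇒m<n∸1 2+∣ps∣≤∣X∣)) ,
  ≤-<-trans (k≤length-cover G (suc (n G)) W cover) (2+m≤n⇒m<n∸1 2+∣ps∣≤∣X∣)
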